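{- In the timed process algebra T-AWN, let $P$ be a state of a parallel process. Then $P\xrightarrow{\mathbf{time}}$ if and only if $P\not\xrightarrow{\mathbf{inb}}$. Here $P\xrightarrow{\mathbf{time}}$ means that $P\xrightarrow{w_1}$ or $P\xrightarrow{R:w_1}$ for some $w_1\in\mathcal{W}$ and $R\subseteq\mathrm{IP}$, and $P\xrightarrow{\mathbf{inb}}$ means that $P\xrightarrow{a}$ for some $a$ of the form $R{:}\mathbf{*cast}(m)$, $\mathbf{deliver}(d)$ or $\tau$.
   Context: $P\xrightarrow{a}$ means that there exists $P'$ with $P\xrightarrow{a}P'$. The auxiliary construct $\mathbf{*cast}$ never occurs inside a $+$-context. Sequential level. Valuations $\xi$ are partial maps from variables to data values (types include TIME, DATA, MSG, IP, $\mathcal{P}(\mathrm{IP})$); $\xi(e)\!\downarrow$ means $e$ is defined under $\xi$. $\mathtt{now}$ is a TIME variable and $\xi[\mathtt{now}{+}{+}]$ increments it by 1. Process names have guarded defining equations $X(\vec{\mathtt{var}})\stackrel{def}{=}p$: every call of a process name in $p$ occurs inside a subexpression $[\varphi]q$, $[\![\mathtt{var}:=e]\!]q$, $\alpha.q$ or $\mathbf{unicast}(dest,ms).q\blacktriangleright r$. Sequential expressions: $SP::=X(\vec e)\mid[\varphi]SP\mid[\![\mathtt{var}:=e]\!]SP\mid SP+SP\mid\alpha.SP\mid\mathbf{unicast}(dest,ms).SP\blacktriangleright SP\mid\mathbf{*cast}_{dsts}(m)[n,o].SP\blacktriangleright SP$, with $\alpha::=\mathbf{broadcast}(ms)\mid\mathbf{groupcast}(dests,ms)\mid\mathbf{send}(ms)\mid\mathbf{deliver}(data)\mid\mathbf{receive}(\mathtt{msg})$.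 Constants $LB,LG,LU>0$ and $\Delta B,\Delta G,\Delta U\ge0$ are fixed. Actions are $\tau$, $R{:}\mathbf{*cast}(m)$, $\mathbf{send}(m)$, $\mathbf{deliver}(d)$, $\mathbf{receive}(m)$, $w_1\in\mathcal{W}=\{\mathrm{w},\mathrm{wr},\mathrm{ws},\mathrm{wrs}\}$ and $R{:}w_1$. Join $\wedge$ on $\mathcal{W}$: $\mathrm{w}$ is neutral, idempotent, $\mathrm{wr}\wedge\mathrm{ws}=\mathrm{wrs}$, and $\mathrm{wrs}$ is absorbing. Sequential rules: - broadcast/groupcast/unicast $\xrightarrow{\tau}$ $\mathbf{*cast}_{\mathrm{IP}}(\xi(ms))[LB,\Delta B].p\blacktriangleright p$ / $\mathbf{*cast}_{\xi(dests)}(\xi(ms))[LG,\Delta G].p\blacktriangleright p$ / $\mathbf{*cast}_{\{\xi(dest)\}}(\xi(ms))[LU,\Delta U].p\blacktriangleright q$ when defined. - For all $R$: $\mathbf{*cast}_{dsts}(m)[n{+}1,o]\cdots\xrightarrow{R:\mathrm{w}}$ (with $\xi[\mathtt{now}{+}{+}]$) $\mathbf{*cast}_{dsts\cap R}(m)[n,o]\cdots$, and $\mathbf{*cast}_{dsts}(m)[n{+}1,o{+}1]\cdots\xrightarrow{R:\mathrm{w}}\mathbf{*cast}_{dsts\cap R}(m)[n{+}1,o]\cdots$. - $\mathbf{*cast}_{dsts}(m)[0,o].p\blacktriangleright q\xrightarrow{dsts:\mathbf{*cast}(m)}p$ if $dsts\neq\emptyset$, else $\to q$. - $\mathbf{send}(ms).p$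 has $\xrightarrow{\mathbf{send}(\xi(ms))}\xi,p$ and $\xrightarrow{\mathrm{ws}}\xi[\mathtt{now}{+}{+}],\mathbf{send}(ms).p$ when $\xi(ms)\!\downarrow$. - $\mathbf{deliver}(data).p\xrightarrow{\mathbf{deliver}(\xi(data))}p$. - $\mathbf{receive}(\mathtt{msg}).p$ has $\xrightarrow{\mathbf{receive}(m)}\xi[\mathtt{msg}:=m],p$ for all $m$, and $\xrightarrow{\mathrm{wr}}\xi[\mathtt{now}{+}{+}],\mathbf{receive}(\mathtt{msg}).p$. - $[\![\mathtt{var}:=e]\!]p\xrightarrow{\tau}\xi[\mathtt{var}:=\xi(e)],p$. - A state whose leading broadcast/groupcast/unicast/send/deliver/assignment/call has an undefined argument does $\xrightarrow{\mathrm{w}}$ to itself with $\xi[\mathtt{now}{+}{+}]$. - A call $X(\vec e)$ with defined arguments inherits non-wait transitions of $\emptyset[\mathtt{var}_i:=\xi(e_i)],p$, and for each wait action $w_1$ of that state does $\xrightarrow{w_1}\xi[\mathtt{now}{+}{+}],X(\vec e)$. - $[\varphi]p\xrightarrow{\tau}\zeta,p$ for each extension $\zeta$ of $\xi$ to the free variables of $\varphi$ satisfying $\varphi$, else $\xrightarrow{\mathrm{w}}\xi[\mathtt{now}{+}{+}],[\varphi]p$. - $p+q$ inherits the non-wait transitions of both summands, and does $w_1\wedge w_2$ to $\xi[\mathtt{now}{+}{+}],p'+q'$ when $p\xrightarrow{w_1}p'$ and $q\xrightarrow{w_2}q'$. Parallel level: $PP::=\xi,SP\mid PP\langle\!\langle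 PP$. Partial function $\langle\!\langle$ on $\mathcal{W}$: $\mathrm{w}\langle\!\langle(\mathrm{w},\mathrm{wr},\mathrm{ws},\mathrm{wrs})=(\mathrm{w},\mathrm{wr},\mathrm{w},\mathrm{wr})$; $\mathrm{wr}\langle\!\langle(\mathrm{w},\mathrm{wr})=(\mathrm{w},\mathrm{wr})$; $\mathrm{ws}\langle\!\langle(\mathrm{w},\mathrm{wr},\mathrm{ws},\mathrm{wrs})=(\mathrm{ws},\mathrm{wrs},\mathrm{ws},\mathrm{wrs})$; $\mathrm{wrs}\langle\!\langle(\mathrm{w},\mathrm{wr})=(\mathrm{ws},\mathrm{wrs})$; all other combinations are undefined. Parallel rules: - $P\xrightarrow{a}P'$ gives $P\langle\!\langle Q\xrightarrow{a}P'\langle\!\langle Q$ for $a$ not a receive action, not in $\mathcal{W}$ and not of the form $R{:}w_1$. - $Q\xrightarrow{a}Q'$ gives $P\langle\!\langle Q\xrightarrow{a}P\langle\!\langle Q'$ for $a$ not a send action, not in $\mathcal{W}$ and not of the form $R{:}w_1$. - $\mathbf{receive}(m)$ of $P$ with $\mathbf{send}(m)$ of $Q$ gives $\tau$. - $P\xrightarrow{x}P'$, $Q\xrightarrow{y}Q'$ with $x,y$ each either $w_i$ or $R{:}w_i$ (the same $R$ if both) and $w_3=w_1\langle\!\langle w_2$ defined, give $P\langle\!\langle Q\to P'\langle\!\langle Q'$ labelled $w_3$ if both are plain wait actions, and $R{:}w_3$ otherwise. -}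

module Defs where

open import Data.Nat using (ℕ; zero; suc; _<_)
open import Data.Maybe using (Maybe; just; nothing; _>>=_)
open import Data.Product using (Σ; ∃; ∃-syntax; _×_; _,_)
open import Data.Sum using (_⊎_)
open import Data.Unit using (⊤)
open import Data.Empty using (⊥)
open import Data.List using (List)
open import Data.List.Membership.Propositional using (_∈_)
open import Data.Vec using (Vec; []; _∷_)
open import Relation.Nullary using (¬_; yes; no)
open import Relation.Binary.PropositionalEquality using (_≡_)
open import Relation.Binary.Definitions using (DecidableEquality)
open import Function.Bundles using (_⇔_)

data W : Set where
  w wr ws wrs : W

_∧W_ : W → W → W
w   ∧W y   = y
wr  ∧W w   = wr
wr  ∧W wr  = wr
wr  ∧W ws  = wrs
wr  ∧W wrs = wrs
ws  ∧W w   = ws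
ws  ∧W wr  = wrs
ws  ∧W ws  = ws
ws  ∧W wrs = wrs
wrs ∧W y   = wrs

-- partial function ⟨⟨ on W (nothing = undefined)
_⟪⟪_ : W → W → Maybe W
w   ⟪⟪ w   = just w
w   ⟪⟪ wr  = just wr
w   ⟪⟪ ws  = just w
w   ⟪⟪ wrs = just wr
wr  ⟪⟪ w   = just w
wr  ⟪⟪ wr  = just wr
wr  ⟪⟪ ws  = nothing
wr  ⟪⟪ wrs = nothing
ws  ⟪⟪ w   = just ws
ws  ⟪⟪ wr  = just wrs
ws  ⟪⟪ ws  = just ws
ws  ⟪⟪ wrs = just wrs
wrs ⟪⟪ w   = just ws
wrs ⟪⟪ wr  = just wrs
wrs ⟪⟪ ws  = nothing
wrs ⟪⟪ wrs = nothing

record Types : Set₁ where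
  field
    Var   : Set
    _≟V_  : DecidableEquality Var
    now   : Var                  -- the TIME variable now
    IP    : Set
    Msg   : Set
    Data  : Set
    Other : Set                  -- values of all further types
    PName : Set
    arity : PName → ℕ

module Values (T : Types) where
  open Types T

  IPSet : Set₁
  IPSet = IP → Set

  _∩_ : IPSet → IPSet → IPSet
  (A ∩ B) i = A i × B i

  FullIP : IPSet
  FullIP _ = ⊤

  single : IP → IPSet
  single a i = i ≡ a

  NonEmptyIP : IPSet → Set
  NonEmptyIP A = ∃[ i ] A i

  EmptyIP : IPSet → Set
  EmptyIP A = ∀ i → ¬ A i

  data Val : Set₁ where
    tm  : ℕ → Val
    dt  : Data → Val
    ms  : Msg → Val
    ip  : IP → Val
    ips : IPSet → Val
    oth : Other → Val

  asMsg : Val → Maybe Msg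
  asMsg (ms m) = just m
  asMsg _      = nothing

  asData : Val → Maybe Data
  asData (dt d) = just d
  asData _      = nothing

  asIP : Val → Maybe IP
  asIP (ip a) = just a
  asIP _      = nothing

  asIPs : Val → Maybe IPSet
  asIPs (ips A) = just A
  asIPs _       = nothing

  Valuation : Set₁
  Valuation = Var → Maybe Val

  ∅ : Valuation
  ∅ _ = nothing

  _[_≔_] : Valuation → Var → Val → Valuation
  (ξ [ x ≔ a ]) y with y ≟V x
  ... | yes _ = just a
  ... | no  _ = ξ y

  incTime : Maybe Val → Maybe Val
  incTime (just (tm n)) = just (tm (suc n))
  incTime v             = v

  tick : Valuation → Valuation
  tick ξ y with y ≟V now
  ... | yes _ = incTime (ξ now)
  ... | no  _ = ξ y

  bindFrom : ∀ {n} → Valuation → Vec Var n → Vec Val n → Valuation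
  bindFrom ξ []       []       = ξ
  bindFrom ξ (x ∷ xs) (a ∷ as) = bindFrom (ξ [ x ≔ a ]) xs as

  Extends : Valuation → List Var → Valuation → Set₁
  Extends ξ fv ζ =
    (∀ x a → ξ x ≡ just a → ζ x ≡ just a) ×
    (∀ x → x ∈ fv → ∃[ a ] ζ x ≡ just a) ×
    (∀ x a → ζ x ≡ just a → (∃[ b ] ξ x ≡ just b) ⊎ x ∈ fv)

record Sem (T : Types) : Set₂ where
  open Types T
  open Values T
  field
    Exp  : Set
    eval : Exp → Valuation → Maybe Val        -- ξ(e), nothing = undefined
    Cond : Set
    fv   : Cond → List Var
    Sat  : Valuation → Cond → Set
    LB LG LU ΔB ΔG ΔU : ℕ
    LB>0 : 0 < LB
    LG>0 : 0 < LG
    LU>0 : 0 < LU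

module Syntax (T : Types) (E : Sem T) where
  open Types T
  open Values T
  open Sem E

  evalMsg : Exp → Valuation → Maybe Msg
  evalMsg e ξ = eval e ξ >>= asMsg

  evalData : Exp → Valuation → Maybe Data
  evalData e ξ = eval e ξ >>= asData

  evalIP : Exp → Valuation → Maybe IP
  evalIP e ξ = eval e ξ >>= asIP

  evalIPs : Exp → Valuation → Maybe IPSet
  evalIPs e ξ = eval e ξ >>= asIPs

  evalArgs : ∀ {n} → Vec Exp n → Valuation → Maybe (Vec Val n)
  evalArgs []       ξ = just []
  evalArgs (e ∷ es) ξ = eval e ξ >>= λ a → evalArgs es ξ >>= λ as → just (a ∷ as)

  data SP : Set₁ where
    call    : (X : PName) → Vec Exp (arity X) → SP
    guard   : Cond → SP → SP
    assign  : Var → Exp → SP → SP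
    _⊕_     : SP → SP → SP
    bcast   : Exp → SP → SP
    gcast   : Exp → Exp → SP → SP
    ucast   : Exp → Exp → SP → SP → SP
    send    : Exp → SP → SP
    deliver : Exp → SP → SP
    receive : Var → SP → SP
    *cast   : IPSet → Msg → ℕ → ℕ → SP → SP → SP

  data Act : Set₁ where
    τ        : Act
    castA    : IPSet → Msg → Act
    sendA    : Msg → Act
    deliverA : Data → Act
    receiveA : Msg → Act
    waitA    : W → Act
    rwaitA   : IPSet → W → Act

  NonWait : Act → Set
  NonWait (waitA _)    = ⊥
  NonWait (rwaitA _ _) = ⊥
  NonWait _            = ⊤

  NotReceiveNotWait : Act → Set
  NotReceiveNotWait (receiveA _) = ⊥
  NotReceiveNotWait a            = NonWait a

  NotSendNotWait : Act → Set
  NotSendNotWait (sendA _) = ⊥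
  NotSendNotWait a         = NonWait a

  -- guardedness: every call occurs under a guard/assignment/action prefix/unicast
  Guarded : SP → Set
  Guarded (call _ _) = ⊥
  Guarded (p ⊕ q)    = Guarded p × Guarded q
  Guarded _          = ⊤

  NoCast : SP → Set
  NoCast (call _ _)          = ⊤
  NoCast (guard _ p)         = NoCast p
  NoCast (assign _ _ p)      = NoCast p
  NoCast (p ⊕ q)             = NoCast p × NoCast q
  NoCast (bcast _ p)         = NoCast p
  NoCast (gcast _ _ p)       = NoCast p
  NoCast (ucast _ _ p q)     = NoCast p × NoCast q
  NoCast (send _ p)          = NoCast p
  NoCast (deliver _ p)       = NoCast p
  NoCast (receive _ p)       = NoCast p
  NoCast (*cast _ _ _ _ _ _) = ⊥

  NoCastInSum : SP → Set
  NoCastInSum (call _ _)          = ⊤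
  NoCastInSum (guard _ p)         = NoCastInSum p
  NoCastInSum (assign _ _ p)      = NoCastInSum p
  NoCastInSum (p ⊕ q)             = NoCast p × NoCast q
  NoCastInSum (bcast _ p)         = NoCastInSum p
  NoCastInSum (gcast _ _ p)       = NoCastInSum p
  NoCastInSum (ucast _ _ p q)     = NoCastInSum p × NoCastInSum q
  NoCastInSum (send _ p)          = NoCastInSum p
  NoCastInSum (deliver _ p)       = NoCastInSum p
  NoCastInSum (receive _ p)       = NoCastInSum p
  NoCastInSum (*cast _ _ _ _ p q) = NoCastInSum p × NoCastInSum q

  data PP : Set₁ where
    st   : Valuation → SP → PP
    _⟪_  : PP → PP → PP

  WFState : PP → Set
  WFState (st _ p) = NoCastInSum p
  WFState (P ⟪ Q)  = WFState P × WFState Q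

record Spec (T : Types) (E : Sem T) : Set₁ where
  open Types T
  open Syntax T E
  field
    params  : (X : PName) → Vec Var (arity X)
    body    : PName → SP
    guarded : ∀ X → Guarded (body X)
    nocast  : ∀ X → NoCast (body X)

module Semantics (T : Types) (E : Sem T) (S : Spec T E) where
  open Types T
  open Values T
  open Sem E
  open Syntax T E
  open Spec S

  data Step : Valuation → SP → Act → Valuation → SP → Set₁ where
    bcast-τ : ∀ {ξ ms p m} → evalMsg ms ξ ≡ just m →
      Step ξ (bcast ms p) τ ξ (*cast FullIP m LB ΔB p p)
    bcast-w : ∀ {ξ ms p} → evalMsg ms ξ ≡ nothing →
      Step ξ (bcast ms p) (waitA w) (tick ξ) (bcast ms p)
    gcast-τ : ∀ {ξ ds ms p D m} → evalIPs ds ξ ≡ just D → evalMsg ms ξ ≡ just m →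
      Step ξ (gcast ds ms p) τ ξ (*cast D m LG ΔG p p)
    gcast-w : ∀ {ξ ds ms p} → evalIPs ds ξ ≡ nothing ⊎ evalMsg ms ξ ≡ nothing →
      Step ξ (gcast ds ms p) (waitA w) (tick ξ) (gcast ds ms p)
    ucast-τ : ∀ {ξ d ms p q a m} → evalIP d ξ ≡ just a → evalMsg ms ξ ≡ just m →
      Step ξ (ucast d ms p q) τ ξ (*cast (single a) m LU ΔU p q)
    ucast-w : ∀ {ξ d ms p q} → evalIP d ξ ≡ nothing ⊎ evalMsg ms ξ ≡ nothing →
      Step ξ (ucast d ms p q) (waitA w) (tick ξ) (ucast d ms p q)
    cast-w₁ : ∀ {ξ ds m n o p q} R →
      Step ξ (*cast ds m (suc n) o p q) (rwaitA R w) (tick ξ) (*cast (ds ∩ R) m n o p q)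
    cast-w₂ : ∀ {ξ ds m n o p q} R →
      Step ξ (*cast ds m (suc n) (suc o) p q) (rwaitA R w) (tick ξ) (*cast (ds ∩ R) m (suc n) o p q)
    cast-go : ∀ {ξ ds m o p q} → NonEmptyIP ds →
      Step ξ (*cast ds m 0 o p q) (castA ds m) ξ p
    cast-fail : ∀ {ξ ds m o p q} → EmptyIP ds →
      Step ξ (*cast ds m 0 o p q) τ ξ q
    send-s : ∀ {ξ ms p m} → evalMsg ms ξ ≡ just m →
      Step ξ (send ms p) (sendA m) ξ p
    send-ws : ∀ {ξ ms p m} → evalMsg ms ξ ≡ just m →
      Step ξ (send ms p) (waitA ws) (tick ξ) (send ms p)
    send-w : ∀ {ξ ms p} → evalMsg ms ξ ≡ nothing →
      Step ξ (send ms p) (waitA w) (tick ξ) (send ms p)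
    deliver-d : ∀ {ξ e p d} → evalData e ξ ≡ just d →
      Step ξ (deliver e p) (deliverA d) ξ p
    deliver-w : ∀ {ξ e p} → evalData e ξ ≡ nothing →
      Step ξ (deliver e p) (waitA w) (tick ξ) (deliver e p)
    receive-r : ∀ {ξ x p} m →
      Step ξ (receive x p) (receiveA m) (ξ [ x ≔ ms m ]) p
    receive-wr : ∀ {ξ x p} →
      Step ξ (receive x p) (waitA wr) (tick ξ) (receive x p)
    assign-τ : ∀ {ξ x e p a} → eval e ξ ≡ just a →
      Step ξ (assign x e p) τ (ξ [ x ≔ a ]) p
    assign-w : ∀ {ξ x e p} → eval e ξ ≡ nothing →
      Step ξ (assign x e p) (waitA w) (tick ξ) (assign x e p)
    call-a : ∀ {ξ X es vs a ζ p'} → evalArgs es ξ ≡ just vs → NonWait a →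
      Step (bindFrom ∅ (params X) vs) (body X) a ζ p' →
      Step ξ (call X es) a ζ p'
    call-w : ∀ {ξ X es vs w₁ ζ p'} → evalArgs es ξ ≡ just vs →
      Step (bindFrom ∅ (params X) vs) (body X) (waitA w₁) ζ p' →
      Step ξ (call X es) (waitA w₁) (tick ξ) (call X es)
    call-u : ∀ {ξ X es} → evalArgs es ξ ≡ nothing →
      Step ξ (call X es) (waitA w) (tick ξ) (call X es)
    guard-τ : ∀ {ξ φ p ζ} → Extends ξ (fv φ) ζ → Sat ζ φ →
      Step ξ (guard φ p) τ ζ p
    guard-w : ∀ {ξ φ p} → ¬ (∃[ ζ ] (Extends ξ (fv φ) ζ × Sat ζ φ)) →
      Step ξ (guard φ p) (waitA w) (tick ξ) (guard φ p)
    sum-l : ∀ {ξ p q a ζ p'} → NonWait a → Step ξ p a ζ p' → Step ξ (p ⊕ q) a ζ p'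
    sum-r : ∀ {ξ p q a ζ q'} → NonWait a → Step ξ q a ζ q' → Step ξ (p ⊕ q) a ζ q'
    sum-w : ∀ {ξ p q w₁ w₂ ζ₁ ζ₂ p' q'} →
      Step ξ p (waitA w₁) ζ₁ p' → Step ξ q (waitA w₂) ζ₂ q' →
      Step ξ (p ⊕ q) (waitA (w₁ ∧W w₂)) (tick ξ) (p' ⊕ q')

  data PStep : PP → Act → PP → Set₁ where
    seq : ∀ {ξ p a ζ p'} → Step ξ p a ζ p' → PStep (st ξ p) a (st ζ p')
    par-l : ∀ {P Q a P'} → NotReceiveNotWait a → PStep P a P' → PStep (P ⟪ Q) a (P' ⟪ Q)
    par-r : ∀ {P Q a Q'} → NotSendNotWait a → PStep Q a Q' → PStep (P ⟪ Q) a (P ⟪ Q')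
    par-sync : ∀ {P Q m P' Q'} → PStep P (receiveA m) P' → PStep Q (sendA m) Q' →
      PStep (P ⟪ Q) τ (P' ⟪ Q')
    par-ww : ∀ {P Q w₁ w₂ w₃ P' Q'} → w₁ ⟪⟪ w₂ ≡ just w₃ →
      PStep P (waitA w₁) P' → PStep Q (waitA w₂) Q' → PStep (P ⟪ Q) (waitA w₃) (P' ⟪ Q')
    par-Rw : ∀ {P Q R w₁ w₂ w₃ P' Q'} → w₁ ⟪⟪ w₂ ≡ just w₃ →
      PStep P (rwaitA R w₁) P' → PStep Q (waitA w₂) Q' → PStep (P ⟪ Q) (rwaitA R w₃) (P' ⟪ Q')
    par-wR : ∀ {P Q R w₁ w₂ w₃ P' Q'} → w₁ ⟪⟪ w₂ ≡ just w₃ →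
      PStep P (waitA w₁) P' → PStep Q (rwaitA R w₂) Q' → PStep (P ⟪ Q) (rwaitA R w₃) (P' ⟪ Q')
    par-RR : ∀ {P Q R w₁ w₂ w₃ P' Q'} → w₁ ⟪⟪ w₂ ≡ just w₃ →
      PStep P (rwaitA R w₁) P' → PStep Q (rwaitA R w₂) Q' → PStep (P ⟪ Q) (rwaitA R w₃) (P' ⟪ Q')

  Time : PP → Set₁
  Time P = ∃[ P' ] ((∃[ w₁ ] PStep P (waitA w₁) P') ⊎ (∃[ R ] ∃[ w₁ ] PStep P (rwaitA R w₁) P'))

  Inb : PP → Set₁
  Inb P = ∃[ P' ] ((∃[ R ] ∃[ m ] PStep P (castA R m) P')
                   ⊎ (∃[ d ] PStep P (deliverA d) P')
                   ⊎ PStep P τ P')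

-- A wait label in W is a pair of flags: can the process receive (wr), can it send (ws).
-- The join ∧ is flagwise disjunction, and w₁ ⟨⟨ w₂ keeps the send flag of w₁ and the
-- receive flag of w₂, being undefined exactly when w₁ receives and w₂ sends.
-- Time excludes inb: by induction on transitions, a non-wait action enabled beside a
-- time step is a receive or send permitted by the flags of its label, never an inb
-- action; at a parallel composition the only other candidate, a synchronising τ, would
-- need the receiving component to receive and the other to send, where ⟨⟨ is undefined.
-- No inb gives time: every well-formed inb-free state can let time pass with a label
-- whose flags are backed by actual receive and send transitions; for P ⟨⟨ Q these
-- witnesses show that the labels of P and Q compose, since otherwise a τ would be enabled.

module Submission where

open import Defs
open import Data.Bool using (Bool; true; false; T; _∨_)
open import Data.Bool.Properties using (T-∨)
open import Data.Empty using (⊥; ⊥-elim)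
open import Data.Maybe using (Maybe; just; nothing)
open import Data.Nat using (zero; suc)
open import Data.Product using (∃-syntax; _×_; _,_; -,_; proj₁; proj₂; map; map₂)
open import Data.Sum using (_⊎_; inj₁; inj₂; [_,_])
open import Data.Unit using (⊤; tt)
open import Function.Bundles using (_⇔_; mk⇔; Equivalence)
open import Relation.Nullary using (¬_)
open import Relation.Binary.PropositionalEquality using (_≡_; refl; sym; trans; subst)

open Equivalence using (to; from)

≡nothing⇒≢just : ∀ {a} {A : Set a} {x : Maybe A} {y : A} → x ≡ nothing → ¬ x ≡ just y
≡nothing⇒≢just refl ()

canReceive canSend : W → Bool
canReceive wr  = true
canReceive wrs = true
canReceive _   = false

canSend ws  = true
canSend wrs = true
canSend _   = false

canReceive-∧ : ∀ a b → canReceive (a ∧W b) ≡ canReceive a ∨ canReceive b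
canReceive-∧ w   b   = refl
canReceive-∧ wrs b   = refl
canReceive-∧ wr  w   = refl
canReceive-∧ wr  wr  = refl
canReceive-∧ wr  ws  = refl
canReceive-∧ wr  wrs = refl
canReceive-∧ ws  w   = refl
canReceive-∧ ws  wr  = refl
canReceive-∧ ws  ws  = refl
canReceive-∧ ws  wrs = refl

canSend-∧ : ∀ a b → canSend (a ∧W b) ≡ canSend a ∨ canSend b
canSend-∧ w   b   = refl
canSend-∧ wrs b   = refl
canSend-∧ wr  w   = refl
canSend-∧ wr  wr  = refl
canSend-∧ wr  ws  = refl
canSend-∧ wr  wrs = refl
canSend-∧ ws  w   = refl
canSend-∧ ws  wr  = refl
canSend-∧ ws  ws  = refl
canSend-∧ ws  wrs = refl

T-canReceive-∧ : ∀ a b → T (canReceive (a ∧W b)) ⇔ (T (canReceive a) ⊎ T (canReceive b))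
T-canReceive-∧ a b rewrite canReceive-∧ a b = T-∨

T-canSend-∧ : ∀ a b → T (canSend (a ∧W b)) ⇔ (T (canSend a) ⊎ T (canSend b))
T-canSend-∧ a b rewrite canSend-∧ a b = T-∨

⟪⟪-flags : ∀ a b {c} → a ⟪⟪ b ≡ just c → canReceive c ≡ canReceive b × canSend c ≡ canSend a
⟪⟪-flags w   w   refl = refl , refl
⟪⟪-flags w   wr  refl = refl , refl
⟪⟪-flags w   ws  refl = refl , refl
⟪⟪-flags w   wrs refl = refl , refl
⟪⟪-flags wr  w   refl = refl , refl
⟪⟪-flags wr  wr  refl = refl , refl
⟪⟪-flags wr  ws  ()
⟪⟪-flags wr  wrs ()
⟪⟪-flags ws  w   refl = refl , refl
⟪⟪-flags ws  wr  refl = refl , refl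
⟪⟪-flags ws  ws  refl = refl , refl
⟪⟪-flags ws  wrs refl = refl , refl
⟪⟪-flags wrs w   refl = refl , refl
⟪⟪-flags wrs wr  refl = refl , refl
⟪⟪-flags wrs ws  ()
⟪⟪-flags wrs wrs ()

⟪⟪-undefined : ∀ a b {c} → T (canReceive a) → T (canSend b) → ¬ a ⟪⟪ b ≡ just c
⟪⟪-undefined w   _   ()
⟪⟪-undefined ws  _   ()
⟪⟪-undefined wr  w   _ ()
⟪⟪-undefined wr  wr  _ ()
⟪⟪-undefined wrs w   _ ()
⟪⟪-undefined wrs wr  _ ()
⟪⟪-undefined wr  ws  _ _ ()
⟪⟪-undefined wr  wrs _ _ ()
⟪⟪-undefined wrs ws  _ _ ()
⟪⟪-undefined wrs wrs _ _ ()

⟪⟪-defined : ∀ a b → ¬ (T (canReceive a) × T (canSend b)) → ∃[ c ] a ⟪⟪ b ≡ just c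
⟪⟪-defined w   w   _ = -, refl
⟪⟪-defined w   wr  _ = -, refl
⟪⟪-defined w   ws  _ = -, refl
⟪⟪-defined w   wrs _ = -, refl
⟪⟪-defined wr  w   _ = -, refl
⟪⟪-defined wr  wr  _ = -, refl
⟪⟪-defined wr  ws  h = ⊥-elim (h (tt , tt))
⟪⟪-defined wr  wrs h = ⊥-elim (h (tt , tt))
⟪⟪-defined ws  w   _ = -, refl
⟪⟪-defined ws  wr  _ = -, refl
⟪⟪-defined ws  ws  _ = -, refl
⟪⟪-defined ws  wrs _ = -, refl
⟪⟪-defined wrs w   _ = -, refl
⟪⟪-defined wrs wr  _ = -, refl
⟪⟪-defined wrs ws  h = ⊥-elim (h (tt , tt))
⟪⟪-defined wrs wrs h = ⊥-elim (h (tt , tt))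

module TimedAWN (Ty : Types) (E : Sem Ty) (S : Spec Ty E) where
  open Values Ty
  open Sem E using (eval)
  open Syntax Ty E
  open Spec S
  open Semantics Ty E S

  IsInb : Act → Set
  IsInb τ            = ⊤
  IsInb (castA _ _)  = ⊤
  IsInb (deliverA _) = ⊤
  IsInb _            = ⊥

  inb⇒nonWait : ∀ {a} → IsInb a → NonWait a
  inb⇒nonWait {τ}          _ = tt
  inb⇒nonWait {castA _ _}  _ = tt
  inb⇒nonWait {deliverA _} _ = tt

  inb⇒notReceive : ∀ {a} → IsInb a → NotReceiveNotWait a
  inb⇒notReceive {τ}          _ = tt
  inb⇒notReceive {castA _ _}  _ = tt
  inb⇒notReceive {deliverA _} _ = tt

  inb⇒notSend : ∀ {a} → IsInb a → NotSendNotWait a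
  inb⇒notSend {τ}          _ = tt
  inb⇒notSend {castA _ _}  _ = tt
  inb⇒notSend {deliverA _} _ = tt

  data Allows (l : W) : Act → Set₁ where
    input  : ∀ {m} → T (canReceive l) → Allows l (receiveA m)
    output : ∀ {m} → T (canSend l) → Allows l (sendA m)

  allows-∧ˡ : ∀ {l₁ l₂ a} → Allows l₁ a → Allows (l₁ ∧W l₂) a
  allows-∧ˡ {l₁} {l₂} (input r)  = input (from (T-canReceive-∧ l₁ l₂) (inj₁ r))
  allows-∧ˡ {l₁} {l₂} (output s) = output (from (T-canSend-∧ l₁ l₂) (inj₁ s))

  allows-∧ʳ : ∀ {l₁ l₂ a} → Allows l₂ a → Allows (l₁ ∧W l₂) a
  allows-∧ʳ {l₁} {l₂} (input r)  = input (from (T-canReceive-∧ l₁ l₂) (inj₂ r))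
  allows-∧ʳ {l₁} {l₂} (output s) = output (from (T-canSend-∧ l₁ l₂) (inj₂ s))

  allows-⟪⟪ˡ : ∀ {l₁ l₂ l a} → l₁ ⟪⟪ l₂ ≡ just l → NotReceiveNotWait a → Allows l₁ a → Allows l a
  allows-⟪⟪ˡ {l₁} {l₂} e _ (output s) = output (subst T (sym (proj₂ (⟪⟪-flags l₁ l₂ e))) s)

  allows-⟪⟪ʳ : ∀ {l₁ l₂ l a} → l₁ ⟪⟪ l₂ ≡ just l → NotSendNotWait a → Allows l₂ a → Allows l a
  allows-⟪⟪ʳ {l₁} {l₂} e _ (input r) = input (subst T (sym (proj₁ (⟪⟪-flags l₁ l₂ e))) r)

  wait-allows : ∀ {ξ p l ζ p' a ζ' p''} →
    Step ξ p (waitA l) ζ p' → Step ξ p a ζ' p'' → NonWait a → Allows l a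
  wait-allows (bcast-w u)        (bcast-τ d)     _ = ⊥-elim (≡nothing⇒≢just u d)
  wait-allows (bcast-w _)        (bcast-w _)     ()
  wait-allows (gcast-w (inj₁ u)) (gcast-τ d _)   _ = ⊥-elim (≡nothing⇒≢just u d)
  wait-allows (gcast-w (inj₂ u)) (gcast-τ _ d)   _ = ⊥-elim (≡nothing⇒≢just u d)
  wait-allows (gcast-w _)        (gcast-w _)     ()
  wait-allows (ucast-w (inj₁ u)) (ucast-τ d _)   _ = ⊥-elim (≡nothing⇒≢just u d)
  wait-allows (ucast-w (inj₂ u)) (ucast-τ _ d)   _ = ⊥-elim (≡nothing⇒≢just u d)
  wait-allows (ucast-w _)        (ucast-w _)     ()
  wait-allows (send-ws _)        (send-s _)      _ = output tt
  wait-allows (send-ws _)        (send-ws _)     ()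
  wait-allows (send-ws _)        (send-w _)      ()
  wait-allows (send-w u)         (send-s d)      _ = ⊥-elim (≡nothing⇒≢just u d)
  wait-allows (send-w _)         (send-ws _)     ()
  wait-allows (send-w _)         (send-w _)      ()
  wait-allows (deliver-w u)      (deliver-d d)   _ = ⊥-elim (≡nothing⇒≢just u d)
  wait-allows (deliver-w _)      (deliver-w _)   ()
  wait-allows receive-wr         (receive-r _)   _ = input tt
  wait-allows receive-wr         receive-wr      ()
  wait-allows (assign-w u)       (assign-τ d)    _ = ⊥-elim (≡nothing⇒≢just u d)
  wait-allows (assign-w _)       (assign-w _)    ()
  wait-allows (call-a _ () _)    _               _
  wait-allows (call-w d s)       (call-a d' _ s') nw with trans (sym d) d'
  ... | refl = wait-allows s s' nw
  wait-allows (call-w _ _)       (call-w _ _)    ()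
  wait-allows (call-w _ _)       (call-u _)      ()
  wait-allows (call-u u)         (call-a d _ _)  _ = ⊥-elim (≡nothing⇒≢just u d)
  wait-allows (call-u _)         (call-w _ _)    ()
  wait-allows (call-u _)         (call-u _)      ()
  wait-allows (guard-w unsat)    (guard-τ ext sat) _ = ⊥-elim (unsat (-, ext , sat))
  wait-allows (guard-w _)        (guard-w _)     ()
  wait-allows (sum-l () _)       _               _
  wait-allows (sum-r () _)       _               _
  wait-allows (sum-w s _)        (sum-l _ s')    nw = allows-∧ˡ (wait-allows s s' nw)
  wait-allows (sum-w _ s)        (sum-r _ s')    nw = allows-∧ʳ (wait-allows s s' nw)
  wait-allows (sum-w _ _)        (sum-w _ _)     ()

  -- Restricted waits only arise from a *cast still in transit.
  restricted-wait-excludes : ∀ {ξ p R l ζ p' a ζ' p''} →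
    Step ξ p (rwaitA R l) ζ p' → Step ξ p a ζ' p'' → ¬ NonWait a
  restricted-wait-excludes (cast-w₁ _)    (cast-w₁ _) ()
  restricted-wait-excludes (cast-w₁ _)    (cast-w₂ _) ()
  restricted-wait-excludes (cast-w₂ _)    (cast-w₁ _) ()
  restricted-wait-excludes (cast-w₂ _)    (cast-w₂ _) ()
  restricted-wait-excludes (call-a _ () _) _          _
  restricted-wait-excludes (sum-l () _)   _           _
  restricted-wait-excludes (sum-r () _)   _           _

  PEnabled : PP → Act → Set₁
  PEnabled P a = ∃[ P' ] PStep P a P'

  data Delay (l : W) : Act → Set₁ where
    plain      : Delay l (waitA l)
    restricted : ∀ R → Delay l (rwaitA R l)

  Delays : PP → W → Set₁
  Delays P l = ∃[ b ] Delay l b × PEnabled P b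

  delays-⟪ : ∀ {P Q l} → Delays (P ⟪ Q) l →
    ∃[ l₁ ] ∃[ l₂ ] l₁ ⟪⟪ l₂ ≡ just l × Delays P l₁ × Delays Q l₂
  delays-⟪ (_ , plain        , _ , par-ww e s t) = -, -, e , (-, plain , -, s) , (-, plain , -, t)
  delays-⟪ (_ , restricted _ , _ , par-Rw e s t) = -, -, e , (-, restricted _ , -, s) , (-, plain , -, t)
  delays-⟪ (_ , restricted _ , _ , par-wR e s t) = -, -, e , (-, plain , -, s) , (-, restricted _ , -, t)
  delays-⟪ (_ , restricted _ , _ , par-RR e s t) = -, -, e , (-, restricted _ , -, s) , (-, restricted _ , -, t)
  delays-⟪ (_ , plain        , _ , par-l () _)
  delays-⟪ (_ , restricted _ , _ , par-l () _)
  delays-⟪ (_ , plain        , _ , par-r () _)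
  delays-⟪ (_ , restricted _ , _ , par-r () _)

  delays-allows : ∀ {P l a P'} → Delays P l → PStep P a P' → NonWait a → Allows l a
  delays-allows (_ , plain , _ , seq s) (seq s') nw = wait-allows s s' nw
  delays-allows (_ , restricted _ , _ , seq s) (seq s') nw = ⊥-elim (restricted-wait-excludes s s' nw)
  delays-allows δ (par-l nr s) nw =
    let _ , _ , e , δP , _ = delays-⟪ δ in allows-⟪⟪ˡ e nr (delays-allows δP s nw)
  delays-allows δ (par-r ns s) nw =
    let _ , _ , e , _ , δQ = delays-⟪ δ in allows-⟪⟪ʳ e ns (delays-allows δQ s nw)
  delays-allows δ (par-sync r s) _ with delays-⟪ δ
  ... | l₁ , l₂ , e , δP , δQ with delays-allows δP r tt | delays-allows δQ s tt
  ... | input canR | output canS = ⊥-elim (⟪⟪-undefined l₁ l₂ canR canS e)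
  delays-allows _ (par-ww _ _ _) ()
  delays-allows _ (par-Rw _ _ _) ()
  delays-allows _ (par-wR _ _ _) ()
  delays-allows _ (par-RR _ _ _) ()

  allows-¬inb : ∀ {l a} → Allows l a → ¬ IsInb a
  allows-¬inb (input _)  ()
  allows-¬inb (output _) ()

  time⇒delays : ∀ {P} → Time P → ∃[ l ] Delays P l
  time⇒delays (_ , inj₁ (_ , s))     = -, -, plain , -, s
  time⇒delays (_ , inj₂ (R , _ , s)) = -, -, restricted R , -, s

  time⇒¬inb : ∀ {P} → Time P → ¬ Inb P
  time⇒¬inb t (_ , inj₁ (_ , _ , s))   = allows-¬inb (delays-allows (proj₂ (time⇒delays t)) s tt) tt
  time⇒¬inb t (_ , inj₂ (inj₁ (_ , s))) = allows-¬inb (delays-allows (proj₂ (time⇒delays t)) s tt) tt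
  time⇒¬inb t (_ , inj₂ (inj₂ s))      = allows-¬inb (delays-allows (proj₂ (time⇒delays t)) s tt) tt

  Enabled : Valuation → SP → Act → Set₁
  Enabled ξ p a = ∃[ ζ ] ∃[ p' ] Step ξ p a ζ p'

  InbFree : Valuation → SP → Set₁
  InbFree ξ p = ∀ {a ζ p'} → IsInb a → ¬ Step ξ p a ζ p'

  PInbFree : PP → Set₁
  PInbFree P = ∀ {a P'} → IsInb a → ¬ PStep P a P'

  record Idle (ξ : Valuation) (p : SP) : Set₁ where
    field
      label      : W
      wait       : Enabled ξ p (waitA label)
      receiveAny : T (canReceive label) → ∀ m → Enabled ξ p (receiveA m)
      sendSome   : T (canSend label) → ∃[ m ] Enabled ξ p (sendA m)

  record PIdle (P : PP) : Set₁ where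
    field
      label      : W
      delay      : PEnabled P (waitA label) ⊎ (∀ R → PEnabled P (rwaitA R label))
      receiveAny : T (canReceive label) → ∀ m → PEnabled P (receiveA m)
      sendSome   : T (canSend label) → ∃[ m ] PEnabled P (sendA m)

  plain-idle : ∀ {ξ p ζ p'} → Step ξ p (waitA w) ζ p' → Idle ξ p
  plain-idle s = record { label = w ; wait = -, -, s ; receiveAny = λ () ; sendSome = λ () }

  Prefix : SP → Set
  Prefix (call _ _)          = ⊥
  Prefix (_ ⊕ _)             = ⊥
  Prefix (*cast _ _ _ _ _ _) = ⊥
  Prefix _                   = ⊤

  prefix-idle : ∀ ξ p → Prefix p → InbFree ξ p → Idle ξ p
  prefix-idle ξ (guard φ p) _ free = plain-idle (guard-w λ (_ , ext , sat) → free tt (guard-τ ext sat))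
  prefix-idle ξ (assign x e p) _ free with eval e ξ in d
  ... | just _  = ⊥-elim (free tt (assign-τ d))
  ... | nothing = plain-idle (assign-w d)
  prefix-idle ξ (bcast e p) _ free with evalMsg e ξ in d
  ... | just _  = ⊥-elim (free tt (bcast-τ d))
  ... | nothing = plain-idle (bcast-w d)
  prefix-idle ξ (gcast ds e p) _ free with evalIPs ds ξ in d₁ | evalMsg e ξ in d₂
  ... | just _  | just _  = ⊥-elim (free tt (gcast-τ d₁ d₂))
  ... | nothing | _       = plain-idle (gcast-w (inj₁ d₁))
  ... | just _  | nothing = plain-idle (gcast-w (inj₂ d₂))
  prefix-idle ξ (ucast dst e p q) _ free with evalIP dst ξ in d₁ | evalMsg e ξ in d₂
  ... | just _  | just _  = ⊥-elim (free tt (ucast-τ d₁ d₂))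
  ... | nothing | _       = plain-idle (ucast-w (inj₁ d₁))
  ... | just _  | nothing = plain-idle (ucast-w (inj₂ d₂))
  prefix-idle ξ (send e p) _ free with evalMsg e ξ in d
  ... | just m  = record { label = ws ; wait = -, -, send-ws d ; receiveAny = λ ()
                         ; sendSome = λ _ → m , -, -, send-s d }
  ... | nothing = plain-idle (send-w d)
  prefix-idle ξ (deliver e p) _ free with evalData e ξ in d
  ... | just _  = ⊥-elim (free tt (deliver-d d))
  ... | nothing = plain-idle (deliver-w d)
  prefix-idle ξ (receive x p) _ _ =
    record { label = wr ; wait = -, -, receive-wr ; receiveAny = λ _ m → -, -, receive-r m ; sendSome = λ () }

  ⊕-idle : ∀ {ξ p q} → Idle ξ p → Idle ξ q → Idle ξ (p ⊕ q)
  ⊕-idle I J = record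
    { label      = I.label ∧W J.label
    ; wait       = -, -, sum-w (proj₂ (proj₂ I.wait)) (proj₂ (proj₂ J.wait))
    ; receiveAny = λ r m → [ (λ r₁ → map₂ (map₂ (sum-l tt)) (I.receiveAny r₁ m))
                           , (λ r₂ → map₂ (map₂ (sum-r tt)) (J.receiveAny r₂ m)) ]
                           (to (T-canReceive-∧ I.label J.label) r)
    ; sendSome   = λ s → [ (λ s₁ → map₂ (map₂ (map₂ (sum-l tt))) (I.sendSome s₁))
                         , (λ s₂ → map₂ (map₂ (map₂ (sum-r tt))) (J.sendSome s₂)) ]
                         (to (T-canSend-∧ I.label J.label) s)
    }
    where
      module I = Idle I
      module J = Idle J

  inbFree-⊕ˡ : ∀ {ξ p q} → InbFree ξ (p ⊕ q) → InbFree ξ p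
  inbFree-⊕ˡ free i s = free i (sum-l (inb⇒nonWait i) s)

  inbFree-⊕ʳ : ∀ {ξ p q} → InbFree ξ (p ⊕ q) → InbFree ξ q
  inbFree-⊕ʳ free i s = free i (sum-r (inb⇒nonWait i) s)

  call-idle : ∀ {ξ X es} → InbFree ξ (call X es) →
    (∀ vs → InbFree (bindFrom ∅ (params X) vs) (body X) → Idle (bindFrom ∅ (params X) vs) (body X)) →
    Idle ξ (call X es)
  call-idle {ξ} {X} {es} free body-idle with evalArgs es ξ in d
  ... | nothing = plain-idle (call-u d)
  ... | just vs = record
    { label      = B.label
    ; wait       = -, -, call-w d (proj₂ (proj₂ B.wait))
    ; receiveAny = λ r m → map₂ (map₂ (call-a d tt)) (B.receiveAny r m)
    ; sendSome   = λ s → map₂ (map₂ (map₂ (call-a d tt))) (B.sendSome s)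
    }
    where
      module B = Idle (body-idle vs λ i s → free i (call-a d (inb⇒nonWait i) s))

  guarded-idle : ∀ ξ p → Guarded p → NoCast p → InbFree ξ p → Idle ξ p
  guarded-idle ξ (p ⊕ q) (gp , gq) (np , nq) free =
    ⊕-idle (guarded-idle ξ p gp np (inbFree-⊕ˡ free)) (guarded-idle ξ q gq nq (inbFree-⊕ʳ free))
  guarded-idle ξ p@(guard _ _)       _ _ = prefix-idle ξ p tt
  guarded-idle ξ p@(assign _ _ _)    _ _ = prefix-idle ξ p tt
  guarded-idle ξ p@(bcast _ _)       _ _ = prefix-idle ξ p tt
  guarded-idle ξ p@(gcast _ _ _)     _ _ = prefix-idle ξ p tt
  guarded-idle ξ p@(ucast _ _ _ _)   _ _ = prefix-idle ξ p tt
  guarded-idle ξ p@(send _ _)        _ _ = prefix-idle ξ p tt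
  guarded-idle ξ p@(deliver _ _)     _ _ = prefix-idle ξ p tt
  guarded-idle ξ p@(receive _ _)     _ _ = prefix-idle ξ p tt

  -- Guardedness of process bodies makes this unfolding of calls terminate.
  idle : ∀ ξ p → NoCast p → InbFree ξ p → Idle ξ p
  idle ξ (call X es) _ free = call-idle free λ vs → guarded-idle _ (body X) (guarded X) (nocast X)
  idle ξ (p ⊕ q) (np , nq) free = ⊕-idle (idle ξ p np (inbFree-⊕ˡ free)) (idle ξ q nq (inbFree-⊕ʳ free))
  idle ξ p@(guard _ _)     _ = prefix-idle ξ p tt
  idle ξ p@(assign _ _ _)  _ = prefix-idle ξ p tt
  idle ξ p@(bcast _ _)     _ = prefix-idle ξ p tt
  idle ξ p@(gcast _ _ _)   _ = prefix-idle ξ p tt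
  idle ξ p@(ucast _ _ _ _) _ = prefix-idle ξ p tt
  idle ξ p@(send _ _)      _ = prefix-idle ξ p tt
  idle ξ p@(deliver _ _)   _ = prefix-idle ξ p tt
  idle ξ p@(receive _ _)   _ = prefix-idle ξ p tt

  seq-pidle : ∀ {ξ p} → Idle ξ p → PIdle (st ξ p)
  seq-pidle I = record
    { label      = I.label
    ; delay      = inj₁ (-, seq (proj₂ (proj₂ I.wait)))
    ; receiveAny = λ r m → -, seq (proj₂ (proj₂ (I.receiveAny r m)))
    ; sendSome   = λ s → let m , _ , _ , t = I.sendSome s in m , -, seq t
    }
    where module I = Idle I

  st-pidle : ∀ ξ p → NoCastInSum p → InbFree ξ p → PIdle (st ξ p)
  st-pidle ξ (*cast ds m (suc n) o p q) _ _ = record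
    { label = w ; delay = inj₂ λ R → -, seq (cast-w₁ R) ; receiveAny = λ () ; sendSome = λ () }
  -- A *cast due now performs either the *cast or, with no destination left, a τ.
  st-pidle ξ (*cast ds m zero o p q) _ free = ⊥-elim (free tt (cast-fail λ i i∈ds → free tt (cast-go (i , i∈ds))))
  st-pidle ξ p@(call _ _)      nc free = seq-pidle (idle ξ p nc free)
  st-pidle ξ p@(_ ⊕ _)         nc free = seq-pidle (idle ξ p nc free)
  st-pidle ξ p@(guard _ _)     _ free = seq-pidle (prefix-idle ξ p tt free)
  st-pidle ξ p@(assign _ _ _)  _ free = seq-pidle (prefix-idle ξ p tt free)
  st-pidle ξ p@(bcast _ _)     _ free = seq-pidle (prefix-idle ξ p tt free)
  st-pidle ξ p@(gcast _ _ _)   _ free = seq-pidle (prefix-idle ξ p tt free)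
  st-pidle ξ p@(ucast _ _ _ _) _ free = seq-pidle (prefix-idle ξ p tt free)
  st-pidle ξ p@(send _ _)      _ free = seq-pidle (prefix-idle ξ p tt free)
  st-pidle ξ p@(deliver _ _)   _ free = seq-pidle (prefix-idle ξ p tt free)
  st-pidle ξ p@(receive _ _)   _ free = seq-pidle (prefix-idle ξ p tt free)

  ⟪-pidle : ∀ {P Q} → PInbFree (P ⟪ Q) → PIdle P → PIdle Q → PIdle (P ⟪ Q)
  ⟪-pidle {P} {Q} free I J = record
    { label      = l
    ; delay      = delay I.delay J.delay
    ; receiveAny = λ r m → map (P ⟪_) (par-r tt) (J.receiveAny (subst T (proj₁ flags) r) m)
    ; sendSome   = λ s → map₂ (map (_⟪ Q) (par-l tt)) (I.sendSome (subst T (proj₂ flags) s))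
    }
    where
      module I = PIdle I
      module J = PIdle J

      no-sync : ¬ (T (canReceive I.label) × T (canSend J.label))
      no-sync (r , s) = let m , _ , t = J.sendSome s in free tt (par-sync (proj₂ (I.receiveAny r m)) t)

      l : W
      l = proj₁ (⟪⟪-defined I.label J.label no-sync)

      composable : I.label ⟪⟪ J.label ≡ just l
      composable = proj₂ (⟪⟪-defined I.label J.label no-sync)

      flags : canReceive l ≡ canReceive J.label × canSend l ≡ canSend I.label
      flags = ⟪⟪-flags I.label J.label composable

      delay : PEnabled P (waitA I.label) ⊎ (∀ R → PEnabled P (rwaitA R I.label)) →
              PEnabled Q (waitA J.label) ⊎ (∀ R → PEnabled Q (rwaitA R J.label)) →
              PEnabled (P ⟪ Q) (waitA l) ⊎ (∀ R → PEnabled (P ⟪ Q) (rwaitA R l))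
      delay (inj₁ (_ , s)) (inj₁ (_ , t)) = inj₁ (-, par-ww composable s t)
      delay (inj₂ f)       (inj₁ (_ , t)) = inj₂ λ R → -, par-Rw composable (proj₂ (f R)) t
      delay (inj₁ (_ , s)) (inj₂ g)       = inj₂ λ R → -, par-wR composable s (proj₂ (g R))
      delay (inj₂ f)       (inj₂ g)       = inj₂ λ R → -, par-RR composable (proj₂ (f R)) (proj₂ (g R))

  pidle : ∀ P → WFState P → PInbFree P → PIdle P
  pidle (st ξ p) wf free = st-pidle ξ p wf λ i s → free i (seq s)
  pidle (P ⟪ Q) (wfP , wfQ) free = ⟪-pidle free
    (pidle P wfP λ i s → free i (par-l (inb⇒notReceive i) s))
    (pidle Q wfQ λ i s → free i (par-r (inb⇒notSend i) s))

  ¬inb⇒inbFree : ∀ {P} → ¬ Inb P → PInbFree P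
  ¬inb⇒inbFree ¬inb {τ}          _ s = ¬inb (-, inj₂ (inj₂ s))
  ¬inb⇒inbFree ¬inb {castA R m}  _ s = ¬inb (-, inj₁ (R , m , s))
  ¬inb⇒inbFree ¬inb {deliverA d} _ s = ¬inb (-, inj₂ (inj₁ (d , s)))

  ¬inb⇒time : ∀ P → WFState P → ¬ Inb P → Time P
  ¬inb⇒time P wf ¬inb with PIdle.delay (pidle P wf (¬inb⇒inbFree ¬inb))
  ... | inj₁ (P' , s) = P' , inj₁ (-, s)
  ... | inj₂ f        = proj₁ (f FullIP) , inj₂ (FullIP , -, proj₂ (f FullIP))

corollary1 : (T : Types) (E : Sem T) (S : Spec T E) (P : Syntax.PP T E) →
    Syntax.WFState T E P →
    Semantics.Time T E S P ⇔ (¬ Semantics.Inb T E S P)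
corollary1 T E S P wf = mk⇔ time⇒¬inb (¬inb⇒time P wf)
  where open TimedAWN T E S
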